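{- Let $R$ be a commutative chain ring with maximal ideal $\mathfrak{m}$ satisfying $\bigcap_{\ell\ge1}\mathfrak{m}^\ell=\{0\}$, let $V$ be an $R$-module, $E$ a finite set and $A\colon E\to V$. For $S\subseteq E$ let $V_S$ be the $R$-submodule generated by $\{A(i):i\in S\}$. Then the rank function of the independence system $M[A]$ satisfies $r_{M[A]}(X)=\mu_R(V_X)$ for all $X\subseteq E$.
   Context: A chain ring is a commutative ring whose ideals are totally ordered by inclusion (it is local). $\mu_R(W)=\dim_{R/\mathfrak{m}}(W/\mathfrak{m}W)$ for finitely generated $W$. Vectors $v_1,\dots,v_\ell$ are modular independent if $\sum\alpha_iv_i=0$ implies all $\alpha_i\in\mathfrak{m}$. $M[A]$ is the independence system on $E$ whose independent sets are the $I$ with $(A(i))_{i\in I}$ modular independent; $r_{M[A]}(X)=\max\{|I|:I\subseteq X \text{ independent}\}$. -}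

module Defs where

open import Level using (Level; _⊔_)
open import Data.Nat using (ℕ; zero; suc; _≤_)
open import Data.Fin using (Fin; zero; suc)
open import Data.Fin.Subset using (Subset; _∈_; _∉_; _⊆_; ∣_∣)
open import Data.Product using (Σ; ∃; ∃-syntax; _×_; _,_)
open import Data.Sum using (_⊎_)
open import Relation.Nullary using (¬_)
open import Relation.Binary.PropositionalEquality using (_≡_)
open import Algebra.Bundles using (CommutativeRing)
open import Algebra.Module.Bundles using (Module)

module OverRing {c ℓ : Level} (R : CommutativeRing c ℓ) where
  open CommutativeRing R using (Carrier; _≈_; _+_; _*_; 0#; 1#)

  Σᴿ : {k : ℕ} → (Fin k → Carrier) → Carrier
  Σᴿ {zero}  f = 0#
  Σᴿ {suc k} f = f zero + Σᴿ (λ j → f (suc j))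

  record IsIdeal (I : Carrier → Set (c ⊔ ℓ)) : Set (c ⊔ ℓ) where
    field
      resp  : ∀ {x y} → x ≈ y → I x → I y
      zero∈ : I 0#
      +∈    : ∀ {x y} → I x → I y → I (x + y)
      *∈    : ∀ r {x} → I x → I (r * x)

  -- units and the maximal ideal of a local ring (= the set of non-units)
  IsUnit : Carrier → Set (c ⊔ ℓ)
  IsUnit x = ∃[ y ] (x * y ≈ 1#)

  𝔪 : Carrier → Set (c ⊔ ℓ)
  𝔪 x = ¬ IsUnit x

  record IsChainRing : Set (Level.suc (c ⊔ ℓ)) where
    field
      nontrivial : ¬ (1# ≈ 0#)
      chain : (I J : Carrier → Set (c ⊔ ℓ)) → IsIdeal I → IsIdeal J →
              (∀ {x} → I x → J x) ⊎ (∀ {x} → J x → I x)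

  𝔪^ : ℕ → Carrier → Set (c ⊔ ℓ)
  𝔪^ zero    x = Level.Lift (c ⊔ ℓ) Data.Unit.⊤
    where import Data.Unit
  𝔪^ (suc n) x = ∃[ k ] Σ (Fin k → Carrier) λ a → Σ (Fin k → Carrier) λ b →
                   (∀ j → 𝔪 (a j)) × (∀ j → 𝔪^ n (b j)) × (x ≈ Σᴿ (λ j → a j * b j))

  PowersOf𝔪IntersectToZero : Set (c ⊔ ℓ)
  PowersOf𝔪IntersectToZero = ∀ x → (∀ n → 𝔪^ (suc n) x) → x ≈ 0#

  module OverModule {m ℓm : Level} (V : Module R m ℓm) where
    open Module V using (Carrierᴹ; _≈ᴹ_; _+ᴹ_; _*ₗ_; 0ᴹ; -ᴹ_)

    Σᴹ : {k : ℕ} → (Fin k → Carrierᴹ) → Carrierᴹ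
    Σᴹ {zero}  f = 0ᴹ
    Σᴹ {suc k} f = f zero +ᴹ Σᴹ (λ j → f (suc j))

    module _ {n : ℕ} (A : Fin n → Carrierᴹ) where

      ModularIndependent : Subset n → Set (c ⊔ ℓ ⊔ ℓm)
      ModularIndependent I =
        (α : Fin n → Carrier) → (∀ i → i ∉ I → α i ≈ 0#) →
        Σᴹ (λ i → α i *ₗ A i) ≈ᴹ 0ᴹ → ∀ i → i ∈ I → 𝔪 (α i)

      IsRank : Subset n → ℕ → Set (c ⊔ ℓ ⊔ ℓm)
      IsRank X k =
        (∃[ I ] (I ⊆ X × ModularIndependent I × ∣ I ∣ ≡ k))
        × (∀ I → I ⊆ X → ModularIndependent I → ∣ I ∣ ≤ k)

      V⟨_⟩ : Subset n → Carrierᴹ → Set (c ⊔ ℓ ⊔ ℓm)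
      V⟨ S ⟩ v = Σ (Fin n → Carrier) λ α → ((∀ i → i ∉ S → α i ≈ 0#) × v ≈ᴹ Σᴹ (λ i → α i *ₗ A i))

    𝔪· : {p : Level} → (Carrierᴹ → Set p) → Carrierᴹ → Set (c ⊔ ℓ ⊔ m ⊔ ℓm ⊔ p)
    𝔪· W v = ∃[ k ] Σ (Fin k → Carrier) λ a → Σ (Fin k → Carrierᴹ) λ w →
               (∀ j → 𝔪 (a j)) × (∀ j → W (w j)) × (v ≈ᴹ Σᴹ (λ j → a j *ₗ w j))

    -- μ_R(W) = k, i.e. dim_{R/𝔪}(W/𝔪W) = k: there are w_1..w_k ∈ W whose classes
    -- form an R/𝔪-basis of W/𝔪W (spanning, and linearly independent over R/𝔪)
    IsMu : {p : Level} → (Carrierᴹ → Set p) → ℕ → Set (c ⊔ ℓ ⊔ m ⊔ ℓm ⊔ p)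
    IsMu W k = Σ (Fin k → Carrierᴹ) λ w →
      (∀ j → W (w j))
      × (∀ v → W v → Σ (Fin k → Carrier) λ β → 𝔪· W (v +ᴹ (-ᴹ Σᴹ (λ j → β j *ₗ w j))))
      × (∀ (β : Fin k → Carrier) → 𝔪· W (Σᴹ (λ j → β j *ₗ w j)) → ∀ j → 𝔪 (β j))

{-# OPTIONS --safe #-}
module Submission where

-- Over a chain ring the non-units form an ideal 𝔪, and in every finite family of scalars one
-- member divides all the others. This yields a Steinitz exchange lemma modulo any submodule U:
-- if w₁ … w_l lie in the span of g₁ … g_k up to U and are independent modulo U (a combination
-- lying in U has all its coefficients in 𝔪), then l ≤ k; one eliminates the g₁-coordinate with
-- the member of w whose g₁-coefficient divides the others.
-- Removing from X, as long as possible, an element carrying a unit coefficient in a relation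
-- (excluded middle decides whether there is one) leaves a modular independent J ⊆ X that still
-- generates V_X. Exchange modulo 0 bounds every modular independent subset of X by |J|, so
-- r(X) = |J|; exchange modulo 𝔪V_X shows that all μ-bases of V_X have the same size, and A|J is
-- one, so μ(V_X) = |J|.

open import Defs
open import Level using (Level; _⊔_; Lift; lift)
open import Function using (_∘_; id)
open import Data.Nat using (ℕ; zero; suc; _≤_; z≤n; s≤s)
open import Data.Nat.Properties using (≤-antisym)
open import Data.Fin using (Fin; zero; suc; punchIn; _≟_)
open import Data.Fin.Properties using (punchIn-punchOut)
open import Data.Fin.Subset using (Subset; inside; outside; _∈_; _∉_; _⊆_; _⊂_; _─_; ⁅_⁆; ∣_∣)
open import Data.Fin.Subset.Properties using (drop-there; x∈p⇒p-x⊂p; x∈p∧x≢y⇒x∈p-y; p─q⊆p)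
open import Data.Fin.Subset.Induction using (⊂-wellFounded; Acc; acc)
open import Data.Vec using ([]; _∷_; here; there)
open import Data.Vec.Functional using (tail; insertAt; removeAt)
open import Data.Vec.Functional.Properties using (insertAt-lookup; insertAt-punchIn)
open import Data.Product using (Σ-syntax; ∃-syntax; _×_; _,_; proj₁; proj₂; map₂)
open import Data.Sum using (_⊎_; inj₁; inj₂)
open import Data.Empty using (⊥-elim)
open import Relation.Nullary using (¬_; yes; no)
open import Relation.Binary.PropositionalEquality as ≡ using (_≡_; _≢_)
open import Axiom.ExcludedMiddle using (ExcludedMiddle)
open import Algebra.Bundles using (CommutativeRing)
open import Algebra.Module.Bundles using (Module)

enum : ∀ {n} (J : Subset n) → Fin ∣ J ∣ → Fin n
enum (inside  ∷ J) zero    = zero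
enum (inside  ∷ J) (suc j) = suc (enum J j)
enum (outside ∷ J) j       = suc (enum J j)

enum-∈ : ∀ {n} (J : Subset n) (j : Fin ∣ J ∣) → enum J j ∈ J
enum-∈ (inside  ∷ J) zero    = here
enum-∈ (inside  ∷ J) (suc j) = there (enum-∈ J j)
enum-∈ (outside ∷ J) j       = there (enum-∈ J j)

spread : ∀ {a n} {B : Set a} → B → (J : Subset n) → (Fin ∣ J ∣ → B) → Fin n → B
spread z (inside  ∷ J) f zero    = f zero
spread z (inside  ∷ J) f (suc i) = spread z J (tail f) i
spread z (outside ∷ J) f zero    = z
spread z (outside ∷ J) f (suc i) = spread z J f i

spread-∉ : ∀ {a n} {B : Set a} (z : B) (J : Subset n) f {i} → i ∉ J → spread z J f i ≡ z
spread-∉ z (inside  ∷ J) f {zero}  i∉J = ⊥-elim (i∉J here)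
spread-∉ z (inside  ∷ J) f {suc i} i∉J = spread-∉ z J (tail f) (i∉J ∘ there)
spread-∉ z (outside ∷ J) f {zero}  i∉J = ≡.refl
spread-∉ z (outside ∷ J) f {suc i} i∉J = spread-∉ z J f (i∉J ∘ there)

spread-enum : ∀ {a n} {B : Set a} (z : B) (J : Subset n) f j → spread z J f (enum J j) ≡ f j
spread-enum z (inside  ∷ J) f zero    = ≡.refl
spread-enum z (inside  ∷ J) f (suc j) = spread-enum z J (tail f) j
spread-enum z (outside ∷ J) f j       = spread-enum z J f j

module ChainRing {c ℓ} (R : CommutativeRing c ℓ) (isChainRing : OverRing.IsChainRing R) where
  open CommutativeRing R renaming (Carrier to K) hiding (zero)
  open OverRing R
  open IsChainRing isChainRing
  open import Algebra.Definitions.RawMagma *-rawMagma public using (_∣_; _∣ʳ_; _,_)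
  open import Algebra.Properties.Semiring.Divisibility semiring using (∣ʳ-refl; ∣ʳ-trans)

  private variable x y : K

  𝔪-resp : x ≈ y → 𝔪 x → 𝔪 y
  𝔪-resp x≈y x∈𝔪 (z , yz≈1) = x∈𝔪 (z , trans (*-congʳ x≈y) yz≈1)

  0∈𝔪 : 𝔪 0#
  0∈𝔪 (z , 0z≈1) = nontrivial (trans (sym 0z≈1) (zeroˡ z))

  1∉𝔪 : ¬ 𝔪 1#
  1∉𝔪 1∈𝔪 = 1∈𝔪 (1# , *-identityˡ 1#)

  𝔪-*ˡ : ∀ r → 𝔪 x → 𝔪 (r * x)
  𝔪-*ˡ {x} r x∈𝔪 (z , rxz≈1) =
    x∈𝔪 (r * z , trans (sym (*-assoc x r z)) (trans (*-congʳ (*-comm x r)) rxz≈1))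

  𝔪-*ʳ : ∀ r → 𝔪 x → 𝔪 (x * r)
  𝔪-*ʳ r x∈𝔪 = 𝔪-resp (*-comm r _) (𝔪-*ˡ r x∈𝔪)

  multiples-isIdeal : ∀ a → IsIdeal (a ∣_)
  multiples-isIdeal a = record
    { resp  = λ { x≈y (q , qa≈x) → q , trans qa≈x x≈y }
    ; zero∈ = 0# , zeroˡ a
    ; +∈    = λ { (q , qa≈x) (q′ , q′a≈y) →
                  q + q′ , trans (distribʳ a q q′) (+-cong qa≈x q′a≈y) }
    ; *∈    = λ { r (q , qa≈x) → r * q , trans (*-assoc r q a) (*-congˡ qa≈x) }
    }

  ∣-total : ∀ a b → (a ∣ b) ⊎ (b ∣ a)
  ∣-total a b with chain (a ∣_) (b ∣_) (multiples-isIdeal a) (multiples-isIdeal b)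
  ... | inj₁ a∣⇒b∣ = inj₂ (a∣⇒b∣ ∣ʳ-refl)
  ... | inj₂ b∣⇒a∣ = inj₁ (b∣⇒a∣ ∣ʳ-refl)

  ∣-least : ∀ {l} (f : Fin (suc l) → K) → ∃[ p ] (∀ i → f p ∣ f i)
  ∣-least {zero}  f = zero , λ { zero → ∣ʳ-refl }
  ∣-least {suc l} f with ∣-least (tail f)
  ... | p , fp∣ with ∣-total (f zero) (f (suc p))
  ...   | inj₁ f0∣fp = zero , λ { zero → ∣ʳ-refl ; (suc i) → ∣ʳ-trans f0∣fp (fp∣ i) }
  ...   | inj₂ fp∣f0 = suc p , λ { zero → fp∣f0 ; (suc i) → fp∣ i }

  𝔪-+-multiple : x ∣ y → 𝔪 x → 𝔪 (x + y)
  𝔪-+-multiple {x} (q , qx≈y) x∈𝔪 =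
    𝔪-resp (trans (distribʳ x 1# q) (+-cong (*-identityˡ x) qx≈y)) (𝔪-*ˡ (1# + q) x∈𝔪)

  𝔪-+ : 𝔪 x → 𝔪 y → 𝔪 (x + y)
  𝔪-+ {x} {y} x∈𝔪 y∈𝔪 with ∣-total x y
  ... | inj₁ x∣y = 𝔪-+-multiple x∣y x∈𝔪
  ... | inj₂ y∣x = 𝔪-resp (+-comm y x) (𝔪-+-multiple y∣x y∈𝔪)

module ChainModule {c ℓ m ℓm} (R : CommutativeRing c ℓ) (isChainRing : OverRing.IsChainRing R)
                   (V : Module R m ℓm) where
  open CommutativeRing R renaming (Carrier to K) hiding (zero)
  open OverRing R
  open ChainRing R isChainRing
  open Module V
  open OverModule V
  open import Algebra.Properties.Ring ring using (-‿distribˡ-*; -1*x≈-x)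
  open import Algebra.Properties.AbelianGroup +ᴹ-abelianGroup
    using (⁻¹-∙-comm; ε⁻¹≈ε; x≈y⇒x∙y⁻¹≈ε; inverseˡ-unique)
  open import Algebra.Properties.CommutativeMonoid.Sum +ᴹ-commutativeMonoid
    using (sum; sum-remove; ∑-distrib-+)
  open import Algebra.Solver.CommutativeMonoid +ᴹ-commutativeMonoid using (solve; _⊕_; _⊜_)
  open import Relation.Binary.Reasoning.Setoid ≈ᴹ-setoid

  private variable
    k l : ℕ
    u : Level
    f h : Fin k → Carrierᴹ

  Σᴹ≡sum : (f : Fin k → Carrierᴹ) → Σᴹ f ≡ sum f
  Σᴹ≡sum {zero}  f = ≡.refl
  Σᴹ≡sum {suc k} f = ≡.cong (f zero +ᴹ_) (Σᴹ≡sum (tail f))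

  Σᴹ-cong : (∀ j → f j ≈ᴹ h j) → Σᴹ f ≈ᴹ Σᴹ h
  Σᴹ-cong {zero}  f≈h = ≈ᴹ-refl
  Σᴹ-cong {suc k} f≈h = +ᴹ-cong (f≈h zero) (Σᴹ-cong (f≈h ∘ suc))

  Σᴹ-distrib-+ᴹ : (f h : Fin k → Carrierᴹ) → Σᴹ (λ j → f j +ᴹ h j) ≈ᴹ Σᴹ f +ᴹ Σᴹ h
  Σᴹ-distrib-+ᴹ f h = begin
    Σᴹ (λ j → f j +ᴹ h j)  ≡⟨ Σᴹ≡sum (λ j → f j +ᴹ h j) ⟩
    sum (λ j → f j +ᴹ h j) ≈⟨ ∑-distrib-+ f h ⟩
    sum f +ᴹ sum h         ≡⟨ ≡.cong₂ _+ᴹ_ (Σᴹ≡sum f) (Σᴹ≡sum h) ⟨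
    Σᴹ f +ᴹ Σᴹ h           ∎

  Σᴹ-remove : (p : Fin (suc k)) (f : Fin (suc k) → Carrierᴹ) →
              Σᴹ f ≈ᴹ f p +ᴹ Σᴹ (removeAt f p)
  Σᴹ-remove p f = begin
    Σᴹ f                      ≡⟨ Σᴹ≡sum f ⟩
    sum f                     ≈⟨ sum-remove f ⟩
    f p +ᴹ sum (removeAt f p) ≡⟨ ≡.cong (f p +ᴹ_) (Σᴹ≡sum (removeAt f p)) ⟨
    f p +ᴹ Σᴹ (removeAt f p)  ∎

  *ₗ-distrib-Σᴹ : ∀ r (f : Fin k → Carrierᴹ) → r *ₗ Σᴹ f ≈ᴹ Σᴹ (λ j → r *ₗ f j)
  *ₗ-distrib-Σᴹ {zero}  r f = *ₗ-zeroʳ r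
  *ₗ-distrib-Σᴹ {suc k} r f =
    ≈ᴹ-trans (*ₗ-distribˡ r _ _) (+ᴹ-congˡ (*ₗ-distrib-Σᴹ r (tail f)))

  Σᴹ-enum : ∀ {n} (J : Subset n) (f : Fin n → Carrierᴹ) →
            (∀ i → i ∉ J → f i ≈ᴹ 0ᴹ) → Σᴹ f ≈ᴹ Σᴹ (f ∘ enum J)
  Σᴹ-enum []            f f≈0 = ≈ᴹ-refl
  Σᴹ-enum (inside  ∷ J) f f≈0 =
    +ᴹ-congˡ (Σᴹ-enum J (tail f) (λ i i∉J → f≈0 (suc i) (i∉J ∘ drop-there)))
  Σᴹ-enum (outside ∷ J) f f≈0 = ≈ᴹ-trans (+ᴹ-congʳ (f≈0 zero λ ())) (≈ᴹ-trans (+ᴹ-identityˡ _)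
    (Σᴹ-enum J (tail f) (λ i i∉J → f≈0 (suc i) (i∉J ∘ drop-there))))

  lincomb : (Fin k → K) → (Fin k → Carrierᴹ) → Carrierᴹ
  lincomb β g = Σᴹ (λ j → β j *ₗ g j)

  module _ (g : Fin k → Carrierᴹ) where

    lincomb-cong : {β γ : Fin k → K} → (∀ j → β j ≈ γ j) → lincomb β g ≈ᴹ lincomb γ g
    lincomb-cong β≈γ = Σᴹ-cong (λ j → *ₗ-congʳ (β≈γ j))

    lincomb-+ : (β γ : Fin k → K) → lincomb (λ j → β j + γ j) g ≈ᴹ lincomb β g +ᴹ lincomb γ g
    lincomb-+ β γ = ≈ᴹ-trans (Σᴹ-cong (λ j → *ₗ-distribʳ (g j) (β j) (γ j)))
                             (Σᴹ-distrib-+ᴹ (λ j → β j *ₗ g j) (λ j → γ j *ₗ g j))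

    lincomb-* : ∀ r (β : Fin k → K) → lincomb (λ j → r * β j) g ≈ᴹ r *ₗ lincomb β g
    lincomb-* r β = ≈ᴹ-trans (Σᴹ-cong (λ j → *ₗ-assoc r (β j) (g j)))
                             (≈ᴹ-sym (*ₗ-distrib-Σᴹ r (λ j → β j *ₗ g j)))

    lincomb-linear : (β : Fin k → K) (r : K) (γ : Fin k → K) →
                     lincomb (λ j → β j + r * γ j) g ≈ᴹ lincomb β g +ᴹ r *ₗ lincomb γ g
    lincomb-linear β r γ = ≈ᴹ-trans (lincomb-+ β _) (+ᴹ-congˡ (lincomb-* r γ))

    lincomb-+ᴹ : (β : Fin k → K) (h : Fin k → Carrierᴹ) →
                 lincomb β (λ j → g j +ᴹ h j) ≈ᴹ lincomb β g +ᴹ lincomb β h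
    lincomb-+ᴹ β h = ≈ᴹ-trans (Σᴹ-cong (λ j → *ₗ-distribˡ (β j) (g j) (h j)))
                              (Σᴹ-distrib-+ᴹ (λ j → β j *ₗ g j) (λ j → β j *ₗ h j))

  lincomb-enum : ∀ {n} (J : Subset n) (β : Fin n → K) (g : Fin n → Carrierᴹ) →
                 (∀ i → i ∉ J → β i ≈ 0#) → lincomb β g ≈ᴹ lincomb (β ∘ enum J) (g ∘ enum J)
  lincomb-enum J β g β∉J =
    Σᴹ-enum J _ (λ i i∉J → ≈ᴹ-trans (*ₗ-congʳ (β∉J i i∉J)) (*ₗ-zeroˡ (g i)))

  lincomb-zero : {β : Fin k → K} (g : Fin k → Carrierᴹ) →
                 (∀ j → β j ≈ 0#) → lincomb β g ≈ᴹ 0ᴹ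
  lincomb-zero {zero}  g β≈0 = ≈ᴹ-refl
  lincomb-zero {suc k} g β≈0 = ≈ᴹ-trans
    (+ᴹ-cong (≈ᴹ-trans (*ₗ-congʳ (β≈0 zero)) (*ₗ-zeroˡ (g zero)))
             (lincomb-zero (tail g) (β≈0 ∘ suc)))
    (+ᴹ-identityˡ 0ᴹ)

  lincomb-multiples : (β s : Fin k → K) (v : Carrierᴹ) →
                      lincomb β (λ j → s j *ₗ v) ≈ᴹ Σᴿ (λ j → β j * s j) *ₗ v
  lincomb-multiples {zero}  β s v = ≈ᴹ-sym (*ₗ-zeroˡ v)
  lincomb-multiples {suc k} β s v = begin
    β zero *ₗ (s zero *ₗ v) +ᴹ lincomb (tail β) (λ j → s (suc j) *ₗ v)
      ≈⟨ +ᴹ-cong (≈ᴹ-sym (*ₗ-assoc _ _ v)) (lincomb-multiples (tail β) (tail s) v) ⟩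
    (β zero * s zero) *ₗ v +ᴹ Σᴿ (λ j → β (suc j) * s (suc j)) *ₗ v
      ≈⟨ *ₗ-distribʳ v _ _ ⟨
    Σᴿ (λ j → β j * s j) *ₗ v ∎

  lincomb-insertAt : (β : Fin k → K) (p : Fin (suc k)) (t : K) (g : Fin (suc k) → Carrierᴹ) →
                     lincomb (insertAt β p t) g ≈ᴹ t *ₗ g p +ᴹ lincomb β (removeAt g p)
  lincomb-insertAt β p t g = begin
    lincomb (insertAt β p t) g
      ≈⟨ Σᴹ-remove p (λ i → insertAt β p t i *ₗ g i) ⟩
    insertAt β p t p *ₗ g p +ᴹ Σᴹ (λ j → insertAt β p t (punchIn p j) *ₗ g (punchIn p j))
      ≈⟨ +ᴹ-cong (*ₗ-congʳ (reflexive (insertAt-lookup β p t)))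
                 (Σᴹ-cong (λ j → *ₗ-congʳ (reflexive (insertAt-punchIn β p t j)))) ⟩
    t *ₗ g p +ᴹ lincomb β (removeAt g p) ∎

  δ : Fin k → Fin k → K
  δ {suc k} i = insertAt (λ _ → 0#) i 1#

  δ-diag : (i : Fin k) → δ i i ≡ 1#
  δ-diag {suc k} i = insertAt-lookup _ i 1#

  δ-off : {i t : Fin k} → i ≢ t → δ i t ≡ 0#
  δ-off {suc k} {i} i≢t =
    ≡.trans (≡.cong (δ i) (≡.sym (punchIn-punchOut i≢t))) (insertAt-punchIn _ i 1# _)

  lincomb-δ : (i : Fin k) (g : Fin k → Carrierᴹ) → lincomb (δ i) g ≈ᴹ g i
  lincomb-δ {suc k} i g = begin
    lincomb (δ i) g
      ≈⟨ lincomb-insertAt _ i 1# g ⟩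
    1# *ₗ g i +ᴹ lincomb (λ _ → 0#) (removeAt g i)
      ≈⟨ +ᴹ-cong (*ₗ-identityˡ (g i)) (lincomb-zero (removeAt g i) (λ _ → refl)) ⟩
    g i +ᴹ 0ᴹ
      ≈⟨ +ᴹ-identityʳ (g i) ⟩
    g i ∎

  -ᴹ‿distribʳ-*ₗ : ∀ r x → r *ₗ (-ᴹ x) ≈ᴹ -ᴹ (r *ₗ x)
  -ᴹ‿distribʳ-*ₗ r x = inverseˡ-unique (r *ₗ (-ᴹ x)) (r *ₗ x) (begin
    r *ₗ (-ᴹ x) +ᴹ r *ₗ x ≈⟨ *ₗ-distribˡ r (-ᴹ x) x ⟨
    r *ₗ (-ᴹ x +ᴹ x)      ≈⟨ *ₗ-congˡ (-ᴹ‿inverseˡ x) ⟩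
    r *ₗ 0ᴹ               ≈⟨ *ₗ-zeroʳ r ⟩
    0ᴹ                    ∎)

  record IsSubmodule (U : Carrierᴹ → Set u) : Set (c ⊔ m ⊔ ℓm ⊔ u) where
    field
      resp  : ∀ {x y} → x ≈ᴹ y → U x → U y
      zero∈ : U 0ᴹ
      +∈    : ∀ {x y} → U x → U y → U (x +ᴹ y)
      *∈    : ∀ r {x} → U x → U (r *ₗ x)

  Σᴹ-∈ : ∀ {k} {f : Fin k → Carrierᴹ} {U : Carrierᴹ → Set u} →
         IsSubmodule U → (∀ j → U (f j)) → U (Σᴹ f)
  Σᴹ-∈ {k = zero}  U-sub f∈U = IsSubmodule.zero∈ U-sub
  Σᴹ-∈ {k = suc k} U-sub f∈U = IsSubmodule.+∈ U-sub (f∈U zero) (Σᴹ-∈ U-sub (f∈U ∘ suc))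

  ｛0ᴹ｝ : Carrierᴹ → Set ℓm
  ｛0ᴹ｝ x = x ≈ᴹ 0ᴹ

  ｛0ᴹ｝-isSubmodule : IsSubmodule ｛0ᴹ｝
  ｛0ᴹ｝-isSubmodule = record
    { resp  = λ x≈y x≈0 → ≈ᴹ-trans (≈ᴹ-sym x≈y) x≈0
    ; zero∈ = ≈ᴹ-refl
    ; +∈    = λ x≈0 y≈0 → ≈ᴹ-trans (+ᴹ-cong x≈0 y≈0) (+ᴹ-identityˡ 0ᴹ)
    ; *∈    = λ r x≈0 → ≈ᴹ-trans (*ₗ-congˡ x≈0) (*ₗ-zeroʳ r)
    }

  𝔪Span : (Fin k → Carrierᴹ) → Carrierᴹ → Set (c ⊔ ℓ ⊔ ℓm)
  𝔪Span a v = Σ[ ρ ∈ (Fin _ → K) ] (∀ j → 𝔪 (ρ j)) × v ≈ᴹ lincomb ρ a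

  𝔪Span-isSubmodule : (a : Fin k → Carrierᴹ) → IsSubmodule (𝔪Span a)
  𝔪Span-isSubmodule a = record
    { resp  = λ { x≈y (ρ , ρ∈𝔪 , x≈) → ρ , ρ∈𝔪 , ≈ᴹ-trans (≈ᴹ-sym x≈y) x≈ }
    ; zero∈ = (λ _ → 0#) , (λ _ → 0∈𝔪) , ≈ᴹ-sym (lincomb-zero a (λ _ → refl))
    ; +∈    = λ { (ρ , ρ∈𝔪 , x≈) (σ , σ∈𝔪 , y≈) →
                  (λ j → ρ j + σ j) , (λ j → 𝔪-+ (ρ∈𝔪 j) (σ∈𝔪 j)) ,
                  ≈ᴹ-trans (+ᴹ-cong x≈ y≈) (≈ᴹ-sym (lincomb-+ a ρ σ)) }
    ; *∈    = λ { r (ρ , ρ∈𝔪 , x≈) →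
                  (λ j → r * ρ j) , (λ j → 𝔪-*ˡ r (ρ∈𝔪 j)) ,
                  ≈ᴹ-trans (*ₗ-congˡ x≈) (≈ᴹ-sym (lincomb-* a r ρ)) }
    }

  𝔪·-least : ∀ {p} {W : Carrierᴹ → Set p} {U : Carrierᴹ → Set u} → IsSubmodule U →
             (∀ {r x} → 𝔪 r → W x → U (r *ₗ x)) → ∀ {v} → 𝔪· W v → U v
  𝔪·-least U-sub 𝔪W⊆U (_ , r , x , r∈𝔪 , x∈W , v≈) =
    IsSubmodule.resp U-sub (≈ᴹ-sym v≈) (Σᴹ-∈ U-sub (λ j → 𝔪W⊆U (r∈𝔪 j) (x∈W j)))

  -- For U = 𝔪· W these are literally the spanning and independence clauses of IsMu W.
  InSpanModulo : (Carrierᴹ → Set u) → (Fin k → Carrierᴹ) → Carrierᴹ → Set (c ⊔ u)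
  InSpanModulo U g v = Σ[ β ∈ (Fin _ → K) ] U (v +ᴹ -ᴹ lincomb β g)

  IndependentModulo : (Carrierᴹ → Set u) → (Fin k → Carrierᴹ) → Set (c ⊔ ℓ ⊔ u)
  IndependentModulo U w = ∀ α → U (lincomb α w) → ∀ i → 𝔪 (α i)

  independent⇒independentModulo-𝔪Span : {a : Fin k → Carrierᴹ} →
    IndependentModulo ｛0ᴹ｝ a → IndependentModulo (𝔪Span a) a
  independent⇒independentModulo-𝔪Span {a = a} a-ind α (ρ , ρ∈𝔪 , α≈ρ) j =
    𝔪-resp α-ρ+ρ≈α (𝔪-+ (a-ind α-ρ α-ρ≈0 j) (ρ∈𝔪 j))
    where
    α-ρ = λ i → α i + - 1# * ρ i
    ∑ρ = lincomb ρ a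
    α-ρ≈0 : lincomb α-ρ a ≈ᴹ 0ᴹ
    α-ρ≈0 = begin
      lincomb α-ρ a                ≈⟨ lincomb-linear a α (- 1#) ρ ⟩
      lincomb α a +ᴹ (- 1#) *ₗ ∑ρ  ≈⟨ +ᴹ-congʳ (≈ᴹ-trans α≈ρ (≈ᴹ-sym (*ₗ-identityˡ ∑ρ))) ⟩
      1# *ₗ ∑ρ +ᴹ (- 1#) *ₗ ∑ρ     ≈⟨ *ₗ-distribʳ ∑ρ 1# (- 1#) ⟨
      (1# + - 1#) *ₗ ∑ρ            ≈⟨ *ₗ-congʳ (-‿inverseʳ 1#) ⟩
      0# *ₗ ∑ρ                     ≈⟨ *ₗ-zeroˡ ∑ρ ⟩
      0ᴹ                           ∎
    α-ρ+ρ≈α : α-ρ j + ρ j ≈ α j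
    α-ρ+ρ≈α = trans (+-assoc (α j) _ (ρ j))
      (trans (+-congˡ (trans (+-congʳ (-1*x≈-x (ρ j))) (-‿inverseˡ (ρ j)))) (+-identityʳ (α j)))

  module Modulo {U : Carrierᴹ → Set u} (U-sub : IsSubmodule U) where
    open IsSubmodule U-sub

    infix 4 _∼_
    _∼_ : Carrierᴹ → Carrierᴹ → Set u
    x ∼ y = U (x +ᴹ -ᴹ y)

    ∼-reflexive : ∀ {x y} → x ≈ᴹ y → x ∼ y
    ∼-reflexive x≈y = resp (≈ᴹ-sym (x≈y⇒x∙y⁻¹≈ε x≈y)) zero∈

    ∼-trans : ∀ {x y z} → x ∼ y → y ∼ z → x ∼ z
    ∼-trans {x} {y} {z} x∼y y∼z = resp (begin
      (x +ᴹ -ᴹ y) +ᴹ (y +ᴹ -ᴹ z) ≈⟨ +ᴹ-assoc x (-ᴹ y) _ ⟩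
      x +ᴹ (-ᴹ y +ᴹ (y +ᴹ -ᴹ z)) ≈⟨ +ᴹ-congˡ (+ᴹ-assoc (-ᴹ y) y (-ᴹ z)) ⟨
      x +ᴹ ((-ᴹ y +ᴹ y) +ᴹ -ᴹ z) ≈⟨ +ᴹ-congˡ (+ᴹ-congʳ (-ᴹ‿inverseˡ y)) ⟩
      x +ᴹ (0ᴹ +ᴹ -ᴹ z)          ≈⟨ +ᴹ-congˡ (+ᴹ-identityˡ (-ᴹ z)) ⟩
      x +ᴹ -ᴹ z                  ∎) (+∈ x∼y y∼z)

    +ᴹ-cong∼ : ∀ {x x′ y y′} → x ∼ x′ → y ∼ y′ → x +ᴹ y ∼ x′ +ᴹ y′
    +ᴹ-cong∼ {x} {x′} {y} {y′} x∼x′ y∼y′ = resp (begin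
      (x +ᴹ -ᴹ x′) +ᴹ (y +ᴹ -ᴹ y′)
        ≈⟨ solve 4 (λ a b c d → (a ⊕ b) ⊕ (c ⊕ d) ⊜ (a ⊕ c) ⊕ (b ⊕ d)) ≈ᴹ-refl
                 x (-ᴹ x′) y (-ᴹ y′) ⟩
      (x +ᴹ y) +ᴹ (-ᴹ x′ +ᴹ -ᴹ y′)
        ≈⟨ +ᴹ-congˡ (⁻¹-∙-comm x′ y′) ⟩
      (x +ᴹ y) +ᴹ -ᴹ (x′ +ᴹ y′) ∎) (+∈ x∼x′ y∼y′)

    *ₗ-cong∼ : ∀ r {x y} → x ∼ y → r *ₗ x ∼ r *ₗ y
    *ₗ-cong∼ r {x} {y} x∼y =
      resp (≈ᴹ-trans (*ₗ-distribˡ r x (-ᴹ y)) (+ᴹ-congˡ (-ᴹ‿distribʳ-*ₗ r y))) (*∈ r x∼y)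

    ∼0ᴹ⇒∈ : ∀ {x} → x ∼ 0ᴹ → U x
    ∼0ᴹ⇒∈ {x} = resp (≈ᴹ-trans (+ᴹ-congˡ ε⁻¹≈ε) (+ᴹ-identityʳ x))

    independent⇒∉ : (w : Fin k → Carrierᴹ) → IndependentModulo U w → ∀ i → ¬ U (w i)
    independent⇒∉ w w-ind i w∈U = 1∉𝔪 (𝔪-resp (reflexive (δ-diag i))
      (w-ind (δ i) (resp (≈ᴹ-sym (lincomb-δ i w)) w∈U) i))

    -- Subtracting from every wᵢ the multiple of w_pivot that cancels its g₀-coefficient keeps
    -- the family in the span of tail g, and dropping w_pivot keeps it independent.
    module Elimination (w : Fin (suc l) → Carrierᴹ) (g : Fin (suc k) → Carrierᴹ)
                       (w-span : ∀ i → InSpanModulo U g (w i)) (w-ind : IndependentModulo U w)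
                       where
      β : Fin (suc l) → Fin (suc k) → K
      β i = proj₁ (w-span i)

      c₀ : Fin (suc l) → K
      c₀ i = β i zero

      pivot : Fin (suc l)
      pivot = proj₁ (∣-least c₀)

      pivot∣ : ∀ i → c₀ pivot ∣ c₀ i
      pivot∣ = proj₂ (∣-least c₀)

      d : Fin (suc l) → K
      d i = _∣ʳ_.quotient (pivot∣ i)

      ŵ : Fin (suc l) → Carrierᴹ
      ŵ i = w i +ᴹ (- d i) *ₗ w pivot

      ŵ-span : ∀ i → InSpanModulo U (tail g) (ŵ i)
      ŵ-span i = tail γ , ∼-trans
        (+ᴹ-cong∼ (proj₂ (w-span i)) (*ₗ-cong∼ r (proj₂ (w-span pivot))))
        (∼-reflexive (begin
          lincomb (β i) g +ᴹ r *ₗ lincomb (β pivot) g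
            ≈⟨ lincomb-linear g (β i) r (β pivot) ⟨
          γ zero *ₗ g zero +ᴹ lincomb (tail γ) (tail g)
            ≈⟨ +ᴹ-congʳ (≈ᴹ-trans (*ₗ-congʳ γ₀≈0) (*ₗ-zeroˡ (g zero))) ⟩
          0ᴹ +ᴹ lincomb (tail γ) (tail g)
            ≈⟨ +ᴹ-identityˡ _ ⟩
          lincomb (tail γ) (tail g) ∎))
        where
        r = - d i
        γ : Fin (suc k) → K
        γ j = β i j + r * β pivot j
        γ₀≈0 : γ zero ≈ 0#
        γ₀≈0 = trans
          (+-congˡ (trans (sym (-‿distribˡ-* (d i) (c₀ pivot))) (-‿cong (_∣ʳ_.equality (pivot∣ i)))))
          (-‿inverseʳ (c₀ i))

      ŵ-independent : IndependentModulo U (removeAt ŵ pivot)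
      ŵ-independent α α∈U j = 𝔪-resp (reflexive (insertAt-punchIn α pivot t j))
        (w-ind α̂ (resp eq α∈U) (punchIn pivot j))
        where
        s : Fin l → K
        s j = - d (punchIn pivot j)
        t = Σᴿ (λ j → α j * s j)
        α̂ = insertAt α pivot t
        eq : lincomb α (removeAt ŵ pivot) ≈ᴹ lincomb α̂ w
        eq = begin
          lincomb α (removeAt ŵ pivot)
            ≈⟨ lincomb-+ᴹ (removeAt w pivot) α (λ j → s j *ₗ w pivot) ⟩
          lincomb α (removeAt w pivot) +ᴹ lincomb α (λ j → s j *ₗ w pivot)
            ≈⟨ +ᴹ-congˡ (lincomb-multiples α s (w pivot)) ⟩
          lincomb α (removeAt w pivot) +ᴹ t *ₗ w pivot
            ≈⟨ +ᴹ-comm _ _ ⟩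
          t *ₗ w pivot +ᴹ lincomb α (removeAt w pivot)
            ≈⟨ lincomb-insertAt α pivot t w ⟨
          lincomb α̂ w ∎

    steinitz : (w : Fin l → Carrierᴹ) (g : Fin k → Carrierᴹ) →
               (∀ i → InSpanModulo U g (w i)) → IndependentModulo U w → l ≤ k
    steinitz {zero}          w g w-span w-ind = z≤n
    steinitz {suc l} {zero}  w g w-span w-ind =
      ⊥-elim (independent⇒∉ w w-ind zero (∼0ᴹ⇒∈ (proj₂ (w-span zero))))
    steinitz {suc l} {suc k} w g w-span w-ind =
      s≤s (steinitz (removeAt ŵ pivot) (tail g) (ŵ-span ∘ punchIn pivot) ŵ-independent)
      where open Elimination w g w-span w-ind

  record IsModularBasis {p} (W : Carrierᴹ → Set p) {k} (a : Fin k → Carrierᴹ)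
                        : Set (c ⊔ ℓ ⊔ m ⊔ ℓm ⊔ p) where
    field
      ∈W          : ∀ j → W (a j)
      spans       : ∀ {v} → W v → Σ[ β ∈ (Fin k → K) ] v ≈ᴹ lincomb β a
      independent : IndependentModulo ｛0ᴹ｝ a

    𝔪·⊆𝔪Span : ∀ {v} → 𝔪· W v → 𝔪Span a v
    𝔪·⊆𝔪Span = 𝔪·-least (𝔪Span-isSubmodule a) λ {r} r∈𝔪 x∈W →
      let β , x≈ = spans x∈W in
      (λ j → r * β j) , (λ j → 𝔪-*ʳ (β j) r∈𝔪) ,
      ≈ᴹ-trans (*ₗ-congˡ x≈) (≈ᴹ-sym (lincomb-* a r β))

    𝔪Span⊆𝔪· : ∀ {v} → 𝔪Span a v → 𝔪· W v
    𝔪Span⊆𝔪· (ρ , ρ∈𝔪 , v≈) = k , ρ , a , ρ∈𝔪 , ∈W , v≈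

    independentModulo-𝔪Span : IndependentModulo (𝔪Span a) a
    independentModulo-𝔪Span = independent⇒independentModulo-𝔪Span independent

    isMu : IsMu W k
    isMu = a , ∈W , (λ v v∈W → map₂ (𝔪Span⊆𝔪· ∘ ∼-reflexive) (spans v∈W)) ,
           (λ α → independentModulo-𝔪Span α ∘ 𝔪·⊆𝔪Span)
      where open Modulo (𝔪Span-isSubmodule a)

    isMu⇒≡ : ∀ {k′} → IsMu W k′ → k ≡ k′
    isMu⇒≡ (w , w∈W , w-span , w-ind) = ≤-antisym
      (steinitz a w (λ j → map₂ 𝔪·⊆𝔪Span (w-span (a j) (∈W j))) independentModulo-𝔪Span)
      (steinitz w a (λ i → map₂ ∼-reflexive (spans (w∈W i))) (λ α → w-ind α ∘ 𝔪Span⊆𝔪·))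
      where open Modulo (𝔪Span-isSubmodule a)

    independent-≤ : ∀ {l} (w : Fin l → Carrierᴹ) →
                    (∀ i → W (w i)) → IndependentModulo ｛0ᴹ｝ w → l ≤ k
    independent-≤ w w∈W = steinitz w a (λ i → map₂ ∼-reflexive (spans (w∈W i)))
      where open Modulo ｛0ᴹ｝-isSubmodule

module Generators {c ℓ m ℓm} (R : CommutativeRing c ℓ) (isChainRing : OverRing.IsChainRing R)
                  (V : Module R m ℓm) {n} (A : Fin n → Module.Carrierᴹ V) where
  open CommutativeRing R renaming (Carrier to K) hiding (zero)
  open OverRing R
  open ChainRing R isChainRing
  open Module V
  open OverModule V
  open ChainModule R isChainRing V
  open import Algebra.Properties.Ring ring using (-‿distribˡ-*)
  open import Relation.Binary.Reasoning.Setoid ≈ᴹ-setoid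

  V⟨⟩-∋ : ∀ {S i} → i ∈ S → V⟨_⟩ A S (A i)
  V⟨⟩-∋ {S} {i} i∈S = δ i , δ-∉ , ≈ᴹ-sym (lincomb-δ i A)
    where
    δ-∉ : ∀ t → t ∉ S → δ i t ≈ 0#
    δ-∉ t t∉S = reflexive (δ-off λ i≡t → t∉S (≡.subst (_∈ S) i≡t i∈S))

  V⟨⟩-enum : ∀ {J v} → V⟨_⟩ A J v → Σ[ β ∈ (Fin ∣ J ∣ → K) ] v ≈ᴹ lincomb β (A ∘ enum J)
  V⟨⟩-enum {J} (β , β∉J , v≈) = β ∘ enum J , ≈ᴹ-trans v≈ (lincomb-enum J β A β∉J)

  modularIndependent⇒independent-enum : ∀ {J} → ModularIndependent A J →
                                        IndependentModulo ｛0ᴹ｝ (A ∘ enum J)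
  modularIndependent⇒independent-enum {J} J-ind α α≈0 j =
    𝔪-resp (reflexive (spread-enum 0# J α j)) (J-ind α̂ α̂∉J α̂≈0 (enum J j) (enum-∈ J j))
    where
    α̂ = spread 0# J α
    α̂∉J : ∀ i → i ∉ J → α̂ i ≈ 0#
    α̂∉J i i∉J = reflexive (spread-∉ 0# J α i∉J)
    α̂≈0 : lincomb α̂ A ≈ᴹ 0ᴹ
    α̂≈0 = begin
      lincomb α̂ A
        ≈⟨ lincomb-enum J α̂ A α̂∉J ⟩
      lincomb (α̂ ∘ enum J) (A ∘ enum J)
        ≈⟨ lincomb-cong (A ∘ enum J) (reflexive ∘ spread-enum 0# J α) ⟩
      lincomb α (A ∘ enum J)
        ≈⟨ α≈0 ⟩
      0ᴹ ∎

  record UnitRelation (J : Subset n) : Set (c ⊔ ℓ ⊔ ℓm) where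
    field
      coeff    : Fin n → K
      support  : ∀ i → i ∉ J → coeff i ≈ 0#
      relation : lincomb coeff A ≈ᴹ 0ᴹ
      pivot    : Fin n
      pivot∈J  : pivot ∈ J
      unit     : IsUnit (coeff pivot)

  V⟨⟩-remove : ∀ {J v} (ρ : UnitRelation J) →
               V⟨_⟩ A J v → V⟨_⟩ A (J ─ ⁅ UnitRelation.pivot ρ ⁆) v
  V⟨⟩-remove {J} ρ (β , β∉J , v≈) = β′ , β′∉ , ≈ᴹ-trans v≈ (≈ᴹ-sym lincomb-β′)
    where
    open UnitRelation ρ
    inv = proj₁ unit
    r = - (β pivot * inv)
    β′ : Fin n → K
    β′ i = β i + r * coeff i
    lincomb-β′ : lincomb β′ A ≈ᴹ lincomb β A
    lincomb-β′ = ≈ᴹ-trans (lincomb-linear A β r coeff)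
      (≈ᴹ-trans (+ᴹ-congˡ (≈ᴹ-trans (*ₗ-congˡ relation) (*ₗ-zeroʳ r))) (+ᴹ-identityʳ _))
    β-inv-coeff : β pivot * inv * coeff pivot ≈ β pivot
    β-inv-coeff = trans (*-assoc _ _ _)
      (trans (*-congˡ (trans (*-comm inv _) (proj₂ unit))) (*-identityʳ (β pivot)))
    β′∉ : ∀ i → i ∉ J ─ ⁅ pivot ⁆ → β′ i ≈ 0#
    β′∉ i i∉ with i ≟ pivot
    ... | yes ≡.refl = trans (+-congˡ (trans (sym (-‿distribˡ-* _ _)) (-‿cong β-inv-coeff)))
                             (-‿inverseʳ (β pivot))
    ... | no  i≢p    =
      trans (+-cong (β∉J i i∉J) (trans (*-congˡ (support i i∉J)) (zeroʳ r))) (+-identityʳ 0#)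
      where
      i∉J : i ∉ J
      i∉J i∈J = i∉ (x∈p∧x≢y⇒x∈p-y i∈J i≢p)

  prune : ExcludedMiddle (c ⊔ ℓ ⊔ m ⊔ ℓm) → ∀ J → Acc _⊂_ J →
          ∃[ J′ ] J′ ⊆ J × (∀ {v} → V⟨_⟩ A J v → V⟨_⟩ A J′ v)
                 × ModularIndependent A J′
  prune em J (acc smaller) with em {Lift m (UnitRelation J)}
  ... | no ¬ρ = J , id , id , λ α α∉J relation i i∈J unit → ¬ρ (lift (record
          { coeff = α ; support = α∉J ; relation = relation
          ; pivot = i ; pivot∈J = i∈J ; unit = unit }))
  ... | yes (lift ρ) =
    let open UnitRelation ρ
        J′ , J′⊆ , J⊆J′ , J′-ind =
          prune em (J ─ ⁅ pivot ⁆) (smaller (x∈p⇒p-x⊂p pivot∈J))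
    in J′ , p─q⊆p J _ ∘ J′⊆ , J⊆J′ ∘ V⟨⟩-remove ρ , J′-ind

  modularIndependent-≤ : ∀ {X I k} {a : Fin k → Carrierᴹ} → IsModularBasis (V⟨_⟩ A X) a →
                         I ⊆ X → ModularIndependent A I → ∣ I ∣ ≤ k
  modularIndependent-≤ {I = I} basis I⊆X I-ind =
    IsModularBasis.independent-≤ basis (A ∘ enum I) (λ i → V⟨⟩-∋ (I⊆X (enum-∈ I i)))
      (modularIndependent⇒independent-enum I-ind)

  record IndependentGeneratingSubset (X : Subset n) : Set (c ⊔ ℓ ⊔ m ⊔ ℓm) where
    field
      J             : Subset n
      J⊆X           : J ⊆ X
      J-independent : ModularIndependent A J
      J-basis       : IsModularBasis (V⟨_⟩ A X) (A ∘ enum J)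

  independentGeneratingSubset : ExcludedMiddle (c ⊔ ℓ ⊔ m ⊔ ℓm) → ∀ X →
                                IndependentGeneratingSubset X
  independentGeneratingSubset em X =
    let J , J⊆X , X⊆J , J-ind = prune em X (⊂-wellFounded X) in record
      { J = J ; J⊆X = J⊆X ; J-independent = J-ind
      ; J-basis = record
        { ∈W          = λ j → V⟨⟩-∋ (J⊆X (enum-∈ J j))
        ; spans       = V⟨⟩-enum ∘ X⊆J
        ; independent = modularIndependent⇒independent-enum J-ind
        }
      }

corollary3p9 : ∀ {c ℓ m ℓm} → ExcludedMiddle (c ⊔ ℓ ⊔ m ⊔ ℓm) →
    (R : CommutativeRing c ℓ) → OverRing.IsChainRing R →
    OverRing.PowersOf𝔪IntersectToZero R →
    (V : Module R m ℓm) → (n : ℕ) → (A : Fin n → Module.Carrierᴹ V) →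
    (X : Subset n) → (k : ℕ) →
    (OverRing.OverModule.IsRank R V A X k → OverRing.OverModule.IsMu R V (OverRing.OverModule.V⟨_⟩ R V A X) k)
    × (OverRing.OverModule.IsMu R V (OverRing.OverModule.V⟨_⟩ R V A X) k → OverRing.OverModule.IsRank R V A X k)
corollary3p9 em R isChainRing _ V n A X k = rank⇒μ , μ⇒rank
  where
  open OverRing.OverModule R V
  open ChainModule R isChainRing V using (module IsModularBasis)
  open Generators R isChainRing V A
  open IndependentGeneratingSubset (independentGeneratingSubset em X)
  open IsModularBasis J-basis using (isMu; isMu⇒≡)

  ∣I∣≤∣J∣ : ∀ {I} → I ⊆ X → ModularIndependent A I → ∣ I ∣ ≤ ∣ J ∣
  ∣I∣≤∣J∣ = modularIndependent-≤ J-basis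

  rank⇒μ : IsRank A X k → IsMu (V⟨_⟩ A X) k
  rank⇒μ ((I , I⊆X , I-independent , ∣I∣≡k) , maximal) =
    ≡.subst (IsMu (V⟨_⟩ A X)) ∣J∣≡k isMu
    where
    ∣J∣≡k : ∣ J ∣ ≡ k
    ∣J∣≡k = ≤-antisym (maximal J J⊆X J-independent)
                      (≡.subst (_≤ ∣ J ∣) ∣I∣≡k (∣I∣≤∣J∣ I⊆X I-independent))

  μ⇒rank : IsMu (V⟨_⟩ A X) k → IsRank A X k
  μ⇒rank μ = (J , J⊆X , J-independent , isMu⇒≡ μ) , λ I I⊆X I-independent →
    ≡.subst (∣ I ∣ ≤_) (isMu⇒≡ μ) (∣I∣≤∣J∣ I⊆X I-independent)
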